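{- Let $k \geq 3$ be an integer. Then there exists $n_0=n_0(k)$ such that for every $n\ge n_0$, every graph $G_k \in \mathcal{G}_k$ on $n$ vertices is $k$-vertex-connected.
   Context: For an integer $k\ge 3$, $\mathcal{G}_k$ is the family of all graphs $G_k=(V,E_k)$ on $n$ vertices for which there is a partition $V=V_1\cup\dots\cup V_{k-1}$ such that: (i) $|V_i|\ge 5$ for every $1\le i\le k-1$; (ii) $\delta(G_k)\ge k$; (iii) $G_k[V_i]$ has a Hamilton cycle $C_i$ for every $i$; (iv) for every $1\le i<j\le k-1$, the bipartite subgraph of $G_k$ with parts $V_i$ and $V_j$ (edges of $G_k$ between $V_i$ and $V_j$) contains a matching of size $3$; (v) for every $i$ and every $u\in V_i$, $|\{j\in[k-1]\setminus\{i\} : d_{G_k}(u,V_j)=0\}|\le 1$; (vi) for every $i$ and every $u,v\in V_i$ (distinct), if $|\{j\in[k-1]\setminus\{i\}: d_{G_k}(u,V_j)=0\}| = |\{j\in[k-1]\setminus\{i\}: d_{G_k}(v,V_j)=0\}| = 1$, then $\mathrm{dist}_{C_i}(u,v)\ge 2$. Here $d_{G}(u,T)$ is the number of neighbours of $u$ in $T$, $[k-1]=\{1,\dots,k-1\}$, and $\mathrm{dist}_{C_i}$ is the distance along the cycle $C_i$. -}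

module Defs where

open import Data.Nat using (ℕ; zero; suc; _+_; _∸_; _≤_; _<_)
open import Data.Bool using (Bool; true; false; _∧_; not; if_then_else_)
open import Data.Fin using (Fin; zero; suc; fromℕ; inject₁; toℕ)
open import Data.Fin.Properties using () renaming (_≟_ to _≟ᶠ_)
open import Data.Fin.Subset using (Subset; _∈_; _∉_; ∣_∣)
open import Data.Product using (Σ; ∃; ∃-syntax; _×_; _,_)
open import Data.Sum using (_⊎_)
open import Relation.Nullary using (¬_; Dec; yes; no)
open import Relation.Nullary.Decidable using (⌊_⌋)
open import Relation.Binary.PropositionalEquality using (_≡_; _≢_)
open import Function.Definitions using (Injective)

record Graph (n : ℕ) : Set where
  field
    adj     : Fin n → Fin n → Bool
    sym     : ∀ u v → adj u v ≡ adj v u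
    irrefl  : ∀ v → adj v v ≡ false

open Graph public

Adj : ∀ {n} → Graph n → Fin n → Fin n → Set
Adj G u v = adj G u v ≡ true

count : ∀ {n} → (Fin n → Bool) → ℕ
count {zero}  p = 0
count {suc n} p = (if p zero then 1 else 0) + count (λ i → p (suc i))

deg : ∀ {n} → Graph n → Fin n → ℕ
deg G u = count (adj G u)

MinDegreeAtLeast : ∀ {n} → Graph n → ℕ → Set
MinDegreeAtLeast G k = ∀ v → k ≤ deg G v

partSize : ∀ {n m} → (Fin n → Fin m) → Fin m → ℕ
partSize part i = count (λ v → ⌊ part v ≟ᶠ i ⌋)

degIn : ∀ {n m} → Graph n → (Fin n → Fin m) → Fin n → Fin m → ℕ
degIn G part u j = count (λ v → adj G u v ∧ ⌊ part v ≟ᶠ j ⌋)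

isZero : ℕ → Bool
isZero zero    = true
isZero (suc _) = false

missing : ∀ {n m} → Graph n → (Fin n → Fin m) → Fin n → ℕ
missing G part u =
  count (λ j → not ⌊ j ≟ᶠ part u ⌋ ∧ isZero (degIn G part u j))

-- cyclic successor on Fin (suc l)
next : ∀ {l} → Fin (suc l) → Fin (suc l)
next {zero}  zero = zero
next {suc l} zero = suc zero
next {suc l} (suc i) with next {l} i
... | zero   = zero
... | suc j  = suc (suc j)

-- c is a Hamilton cycle of G[V_i] (V_i = { v | part v ≡ i }):
-- it enumerates V_i injectively (at least 3 vertices) and
-- cyclically consecutive vertices are adjacent in G.
record HamCycle {n m} (G : Graph n) (part : Fin n → Fin m) (i : Fin m) : Set where
  field
    len      : ℕ
    cyc      : Fin (suc len) → Fin n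
    len≥2    : 2 ≤ len
    inj      : Injective _≡_ _≡_ cyc
    inPart   : ∀ j → part (cyc j) ≡ i
    covers   : ∀ v → part v ≡ i → ∃[ j ] cyc j ≡ v
    edges    : ∀ j → Adj G (cyc j) (cyc (next j))

open HamCycle public

CycleConsecutive : ∀ {n m} {G : Graph n} {part : Fin n → Fin m} {i : Fin m} →
                   HamCycle G part i → Fin n → Fin n → Set
CycleConsecutive C u v =
  ∃[ j ] ((cyc C j ≡ u × cyc C (next j) ≡ v) ⊎ (cyc C j ≡ v × cyc C (next j) ≡ u))

CycleDistAtLeast2 : ∀ {n m} {G : Graph n} {part : Fin n → Fin m} {i : Fin m} →
                    HamCycle G part i → Fin n → Fin n → Set
CycleDistAtLeast2 C u v = u ≢ v × ¬ CycleConsecutive C u v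

Matching3 : ∀ {n m} → Graph n → (Fin n → Fin m) → Fin m → Fin m → Set
Matching3 {n} G part i j =
  Σ (Fin 3 → Fin n) λ a → Σ (Fin 3 → Fin n) λ b →
    Injective _≡_ _≡_ a × Injective _≡_ _≡_ b ×
    (∀ t → part (a t) ≡ i) × (∀ t → part (b t) ≡ j) ×
    (∀ t → Adj G (a t) (b t))

InFamily : (k n : ℕ) → Graph n → Set
InFamily k n G =
  Σ (Fin n → Fin (k ∸ 1)) λ part →
  Σ ((i : Fin (k ∸ 1)) → HamCycle G part i) λ C →
      (∀ i → 5 ≤ partSize part i)
    × MinDegreeAtLeast G k
    -- (iii) is witnessed by C
    × (∀ i j → i ≢ j → Matching3 G part i j)
    × (∀ u → missing G part u ≤ 1)
    × (∀ u v → u ≢ v → part u ≡ part v →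
         missing G part u ≡ 1 → missing G part v ≡ 1 →
         CycleDistAtLeast2 (C (part u)) u v)

data ReachAvoiding {n : ℕ} (G : Graph n) (S : Subset n) : Fin n → Fin n → Set where
  here  : ∀ {u} → u ∉ S → ReachAvoiding G S u u
  step  : ∀ {u w v} → u ∉ S → Adj G u w → ReachAvoiding G S w v →
          ReachAvoiding G S u v

ConnectedAvoiding : ∀ {n} → Graph n → Subset n → Set
ConnectedAvoiding G S = ∀ u v → u ∉ S → v ∉ S → ReachAvoiding G S u v

KConnected : ∀ {n} → ℕ → Graph n → Set
KConnected {n} k G = k < n × (∀ (S : Subset n) → ∣ S ∣ < k → ConnectedAvoiding G S)

module Submission where

-- Let S be a set of fewer than k removed vertices. The load of a part V_j is |S ∩ V_j|; the
-- loads of the k - 1 parts sum to at most k - 1. A part of load at most 1 stays connected along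
-- its Hamilton cycle, and two such light parts keep an edge of their 3-matching, so all light
-- parts are linked through a fixed surviving hub vertex (a light part exists by the load count).
-- A vertex adjacent to an unloaded part reaches the hub as well. A vertex u of a heavy part with
-- no such neighbour misses every unloaded part, so by (v) at most one part is unloaded, and the
-- load count then forces: u's part V_i has load 2, all other parts are light, one is unloaded.
-- Inside V_i, vertices missing no part reach the unloaded part; by (vi) a vertex missing a part
-- has cycle neighbours missing none; a vertex with both cycle neighbours removed leaves through a
-- surviving neighbour (δ ≥ k), and two such vertices in V_i would give |V_i| ≤ 4.

open import Defs hiding (sym)
open import Data.Nat using (ℕ; zero; suc; _+_; _∸_; _≤_; _<_; z≤n; s≤s; _≤?_)
open import Data.Nat.Properties
open import Data.Bool using (Bool; true; false; _∧_; not; if_then_else_; T)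
open import Data.Bool.Properties
  using (∧-zeroʳ; ∧-identityʳ; ∧-inverseʳ; ∧-conicalˡ; ∧-conicalʳ; ¬-not) renaming (_≟_ to _≟ᵇ_)
open import Data.Unit using (tt)
open import Data.Empty using (⊥; ⊥-elim)
open import Data.Product using (∃-syntax; _×_; _,_; proj₁; proj₂)
open import Data.Sum using (_⊎_; inj₁; inj₂)
open import Data.Fin using (Fin; zero; suc; toℕ; inject₁; fromℕ)
open import Data.Fin.Properties
  using (any?; toℕ-injective; toℕ-inject₁; toℕ-inject₁-≢; toℕ-fromℕ; toℕ<n) renaming (_≟_ to _≟ᶠ_)
open import Data.Fin.Subset using (Subset; _∈_; _∉_; ∣_∣)
open import Data.Fin.Subset.Properties using (_∈?_)
open import Data.Vec using ([]; _∷_; lookup)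
open import Data.Vec.Properties using ([]=⇒lookup)
open import Data.List using (List; []; _∷_; length; map)
open import Data.List.Properties using (length-map)
open import Data.List.Relation.Unary.All as All using (All; []; _∷_)
open import Data.List.Relation.Unary.Any using (here; there)
open import Data.List.Relation.Unary.Any.Properties using (¬Any[])
open import Data.List.Relation.Unary.Unique.Propositional using (Unique; []; _∷_)
open import Data.List.Membership.Propositional using () renaming (_∈_ to _∈ₗ_)
open import Data.List.Membership.Propositional.Properties using (∈-map⁺)
open import Function using (_∘_)
open import Relation.Nullary using (¬_; Dec; yes; no)
open import Relation.Nullary.Decidable using (⌊_⌋; isYes≗does; dec-true; dec-false; toWitness; _×-dec_)
open import Relation.Binary.PropositionalEquality
open import Algebra.Properties.CommutativeSemigroup +-commutativeSemigroup using (x∙yz≈y∙xz)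
open import Algebra.Properties.CommutativeMonoid.Sum +-0-commutativeMonoid
  using (sum; sum-cong-≗; ∑-comm; ∑-distrib-+)

⌊⌋-true : ∀ {A : Set} (d : Dec A) → A → ⌊ d ⌋ ≡ true
⌊⌋-true d a = trans (isYes≗does d) (dec-true d a)

⌊⌋-sound : ∀ {A : Set} (d : Dec A) → ⌊ d ⌋ ≡ true → A
⌊⌋-sound d e = toWitness (subst T (sym e) tt)

⌊⌋-false : ∀ {A : Set} (d : Dec A) → ¬ A → ⌊ d ⌋ ≡ false
⌊⌋-false d ¬a = trans (isYes≗does d) (dec-false d ¬a)

ind : Bool → ℕ
ind b = if b then 1 else 0

count-as-sum : ∀ {n} (p : Fin n → Bool) → count p ≡ sum (ind ∘ p)
count-as-sum {zero}  p = refl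
count-as-sum {suc n} p = cong (ind (p zero) +_) (count-as-sum (p ∘ suc))

count-cong : ∀ {n} {p q : Fin n → Bool} → (∀ v → p v ≡ q v) → count p ≡ count q
count-cong {p = p} {q} p≗q = begin
  count p          ≡⟨ count-as-sum p ⟩
  sum (ind ∘ p)    ≡⟨ sum-cong-≗ (cong ind ∘ p≗q) ⟩
  sum (ind ∘ q)    ≡⟨ count-as-sum q ⟨
  count q          ∎
  where open ≡-Reasoning

count-none : ∀ {n} (p : Fin n → Bool) → (∀ v → p v ≡ false) → count p ≡ 0
count-none {zero}  p none = refl
count-none {suc n} p none rewrite none zero = count-none (p ∘ suc) (none ∘ suc)

count-mono : ∀ {n} (p q : Fin n → Bool) → (∀ v → p v ≡ true → q v ≡ true) → count p ≤ count q
count-mono {zero}  p q p⊆q = z≤n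
count-mono {suc n} p q p⊆q with p zero in p₀ | q zero in q₀
... | true  | true  = s≤s (count-mono (p ∘ suc) (q ∘ suc) (p⊆q ∘ suc))
... | true  | false with () ← trans (sym (p⊆q zero p₀)) q₀
... | false | true  = m≤n⇒m≤1+n (count-mono (p ∘ suc) (q ∘ suc) (p⊆q ∘ suc))
... | false | false = count-mono (p ∘ suc) (q ∘ suc) (p⊆q ∘ suc)

count-compl : ∀ {n} (p : Fin n → Bool) → count p + count (not ∘ p) ≡ n
count-compl {zero}  p = refl
count-compl {suc n} p with p zero
... | true  = cong suc (count-compl (p ∘ suc))
... | false = trans (+-suc _ _) (cong suc (count-compl (p ∘ suc)))

count-escape : ∀ {n} (p q : Fin n → Bool) → count q < count p → ∃[ v ] (p v ≡ true × q v ≡ false)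
count-escape {suc n} p q q<p with p zero in p₀ | q zero in q₀
... | true  | false = zero , p₀ , q₀
... | true  | true  with v , pv , qv ← count-escape (p ∘ suc) (q ∘ suc) (≤-pred q<p) = suc v , pv , qv
... | false | false with v , pv , qv ← count-escape (p ∘ suc) (q ∘ suc) q<p = suc v , pv , qv
... | false | true  with v , pv , qv ← count-escape (p ∘ suc) (q ∘ suc) (<⇒≤ q<p) = suc v , pv , qv

count-witness : ∀ {n} (p : Fin n → Bool) → 0 < count p → ∃[ v ] p v ≡ true
count-witness {n} p 0<p
  with v , pv , _ ← count-escape p (λ _ → false) (subst (_< count p) (sym (count-none {n} _ λ _ → refl)) 0<p)
  = v , pv

_∖_ : ∀ {n} → (Fin n → Bool) → Fin n → (Fin n → Bool)
(p ∖ x) v = p v ∧ not ⌊ x ≟ᶠ v ⌋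

∖-true : ∀ {n} {p : Fin n → Bool} {x v} → (p ∖ x) v ≡ true → p v ≡ true × x ≢ v
∖-true {p = p} {x} {v} e with x ≟ᶠ v
... | yes refl with () ← trans (sym e) (∧-zeroʳ (p v))
... | no x≢v = trans (sym (∧-identityʳ (p v))) e , x≢v

true-∖ : ∀ {n} {p : Fin n → Bool} {x v} → p v ≡ true → x ≢ v → (p ∖ x) v ≡ true
true-∖ {x = x} {v} pv x≢v with x ≟ᶠ v
... | yes x≡v = ⊥-elim (x≢v x≡v)
... | no _ rewrite pv = refl

⌊suc≟suc⌋ : ∀ {n} (x y : Fin n) → ⌊ suc x ≟ᶠ suc y ⌋ ≡ ⌊ x ≟ᶠ y ⌋
⌊suc≟suc⌋ x y with x ≟ᶠ y
... | yes _ = refl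
... | no _  = refl

count-split : ∀ {n} (p : Fin n → Bool) x → count p ≡ ind (p x) + count (p ∖ x)
count-split p zero = cong (ind (p zero) +_) (sym (cong₂ _+_
  (cong ind (∧-zeroʳ (p zero)))
  (count-cong (λ v → ∧-identityʳ (p (suc v))))))
count-split p (suc x) = begin
  ind (p zero) + count (p ∘ suc)                           ≡⟨ cong (ind (p zero) +_) (count-split (p ∘ suc) x) ⟩
  ind (p zero) + (ind (p (suc x)) + count ((p ∘ suc) ∖ x)) ≡⟨ x∙yz≈y∙xz (ind (p zero)) (ind (p (suc x))) _ ⟩
  ind (p (suc x)) + (ind (p zero) + count ((p ∘ suc) ∖ x)) ≡⟨ cong (ind (p (suc x)) +_) tail ⟩
  ind (p (suc x)) + count (p ∖ suc x)                       ∎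
  where
    open ≡-Reasoning
    tail : ind (p zero) + count ((p ∘ suc) ∖ x) ≡ count (p ∖ suc x)
    tail = cong₂ _+_ (cong ind (sym (∧-identityʳ (p zero))))
                     (count-cong (λ v → cong (λ b → p (suc v) ∧ not b) (sym (⌊suc≟suc⌋ x v))))

count-lower : ∀ {n} (p : Fin n → Bool) (xs : List (Fin n)) →
              Unique xs → All (λ v → p v ≡ true) xs → length xs ≤ count p
count-lower p []       _             _           = z≤n
count-lower p (x ∷ xs) (x∉xs ∷ uniq) (px ∷ pxs) rewrite count-split p x | px =
  s≤s (count-lower (p ∖ x) xs uniq (All.zipWith (λ (x≢v , pv) → true-∖ {p = p} pv x≢v) (x∉xs , pxs)))

count-upper : ∀ {n} (p : Fin n → Bool) (xs : List (Fin n)) →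
              (∀ v → p v ≡ true → v ∈ₗ xs) → count p ≤ length xs
count-upper p []       cover = ≤-reflexive (count-none p (λ v → ¬-not (¬Any[] ∘ cover v)))
count-upper p (x ∷ xs) cover = begin
  count p                    ≡⟨ count-split p x ⟩
  ind (p x) + count (p ∖ x)  ≤⟨ +-mono-≤ (ind≤1 (p x)) (count-upper (p ∖ x) xs cover′) ⟩
  suc (length xs)            ∎
  where
    open ≤-Reasoning
    ind≤1 : ∀ b → ind b ≤ 1
    ind≤1 true  = ≤-refl
    ind≤1 false = z≤n
    cover′ : ∀ v → (p ∖ x) v ≡ true → v ∈ₗ xs
    cover′ v e with ∖-true {p = p} e
    ... | pv , x≢v with cover v pv
    ... | here v≡x  = ⊥-elim (x≢v (sym v≡x))
    ... | there v∈xs = v∈xs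

count-singleton : ∀ {n} (a : Fin n) → count (λ v → ⌊ a ≟ᶠ v ⌋) ≡ 1
count-singleton a = begin
  count (λ v → ⌊ a ≟ᶠ v ⌋)                         ≡⟨ count-split _ a ⟩
  ind ⌊ a ≟ᶠ a ⌋ + count ((λ v → ⌊ a ≟ᶠ v ⌋) ∖ a)  ≡⟨ cong₂ _+_ (cong ind (⌊⌋-true (a ≟ᶠ a) refl)) no-other ⟩
  1                                                ∎
  where
    open ≡-Reasoning
    no-other : count ((λ v → ⌊ a ≟ᶠ v ⌋) ∖ a) ≡ 0
    no-other = count-none _ (λ v → ∧-inverseʳ ⌊ a ≟ᶠ v ⌋)

card-as-count : ∀ {n} (S : Subset n) → ∣ S ∣ ≡ count (lookup S)
card-as-count []          = refl
card-as-count (true ∷ S)  = cong suc (card-as-count S)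
card-as-count (false ∷ S) = card-as-count S

lookup-false⇒∉ : ∀ {n} {S : Subset n} {v} → lookup S v ≡ false → v ∉ S
lookup-false⇒∉ v∉ v∈ with () ← trans (sym ([]=⇒lookup v∈)) v∉

count-by-parts : ∀ {n m} (p : Fin n → Bool) (part : Fin n → Fin m) →
                 count p ≡ sum (λ j → count (λ v → p v ∧ ⌊ part v ≟ᶠ j ⌋))
count-by-parts {n} {m} p part = begin
  count p                                      ≡⟨ count-as-sum p ⟩
  sum (λ v → ind (p v))                        ≡⟨ sum-cong-≗ {n} split-indicator ⟩
  sum (λ v → sum (λ j → ind (in-part v j)))    ≡⟨ ∑-comm (λ v j → ind (in-part v j)) ⟩
  sum (λ j → sum (λ v → ind (in-part v j)))    ≡⟨ sum-cong-≗ {m} (λ j → count-as-sum (λ v → in-part v j)) ⟨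
  sum (λ j → count (λ v → in-part v j))        ∎
  where
    open ≡-Reasoning
    in-part : Fin n → Fin m → Bool
    in-part v j = p v ∧ ⌊ part v ≟ᶠ j ⌋
    split-indicator : ∀ v → ind (p v) ≡ sum (λ j → ind (in-part v j))
    split-indicator v with p v
    ... | true  = trans (sym (count-singleton (part v))) (count-as-sum (λ j → ⌊ part v ≟ᶠ j ⌋))
    ... | false = trans (sym (count-none {m} (λ _ → false) (λ _ → refl))) (count-as-sum {m} (λ _ → false))

term≤sum : ∀ {m} (f : Fin m → ℕ) i → f i ≤ sum f
term≤sum f zero    = m≤m+n (f zero) _
term≤sum f (suc i) = ≤-trans (term≤sum (f ∘ suc) i) (m≤n+m _ (f zero))

two-terms≤sum : ∀ {m} (f : Fin m → ℕ) {i j} → i ≢ j → f i + f j ≤ sum f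
two-terms≤sum f {zero}  {zero}  i≢j = ⊥-elim (i≢j refl)
two-terms≤sum f {zero}  {suc j} _   = +-monoʳ-≤ (f zero) (term≤sum (f ∘ suc) j)
two-terms≤sum f {suc i} {zero}  _   =
  subst (_≤ sum f) (+-comm (f zero) (f (suc i))) (+-monoʳ-≤ (f zero) (term≤sum (f ∘ suc) i))
two-terms≤sum f {suc i} {suc j} i≢j = ≤-trans (two-terms≤sum (f ∘ suc) (i≢j ∘ cong suc)) (m≤n+m _ (f zero))

-- If m numbers sum to at most m, their total excess over 1 is at most the number of zeros:
-- the nonzero numbers already use one unit each.
excess≤zeros : ∀ {m} (f : Fin m → ℕ) → sum f ≤ m →
               sum (λ j → f j ∸ 1) ≤ count (λ j → isZero (f j))
excess≤zeros {m} f sum≤m = +-cancelˡ-≤ (count nonzero) _ _ (begin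
  count nonzero + sum excess              ≡⟨ cong (_+ sum excess) (count-as-sum nonzero) ⟩
  sum (ind ∘ nonzero) + sum excess        ≡⟨ ∑-distrib-+ (ind ∘ nonzero) excess ⟨
  sum (λ j → ind (nonzero j) + excess j)  ≡⟨ sum-cong-≗ {m} (λ j → split (f j)) ⟨
  sum f                                   ≤⟨ sum≤m ⟩
  m                                       ≡⟨ count-compl zero? ⟨
  count zero? + count nonzero             ≡⟨ +-comm (count zero?) _ ⟩
  count nonzero + count zero?             ∎)
  where
    open ≤-Reasoning
    zero? nonzero : Fin m → Bool
    zero? j = isZero (f j)
    nonzero j = not (zero? j)
    excess : Fin m → ℕ
    excess j = f j ∸ 1
    split : ∀ x → x ≡ ind (not (isZero x)) + (x ∸ 1)
    split zero    = refl
    split (suc x) = refl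

excess-pos : ∀ {x} → 2 ≤ x → 1 ≤ x ∸ 1
excess-pos (s≤s (s≤s _)) = s≤s z≤n

excess≤1 : ∀ x → x ∸ 1 ≤ 1 → x ≤ 2
excess≤1 zero    _ = z≤n
excess≤1 (suc x) h = s≤s h

isZero-false : ∀ {x} → 1 ≤ x → isZero x ≡ false
isZero-false (s≤s _) = refl

isZero-true : ∀ {x} → isZero x ≡ true → x ≡ 0
isZero-true {zero} _ = refl

isZero-false⇒positive : ∀ {x} → isZero x ≡ false → 0 < x
isZero-false⇒positive {suc x} _ = s≤s z≤n

light-part-exists : ∀ {m} (f : Fin (suc m) → ℕ) → sum f ≤ suc m → ∃[ j ] f j ≤ 1
light-part-exists {m} f sum≤m with any? (λ j → f j ≤? 1)
... | yes light = light
... | no ¬light = ⊥-elim (<-irrefl refl (begin-strict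
  0                               <⟨ excess-pos (heavy zero) ⟩
  f zero ∸ 1                      ≤⟨ term≤sum (λ j → f j ∸ 1) zero ⟩
  sum (λ j → f j ∸ 1)             ≤⟨ excess≤zeros f sum≤m ⟩
  count (λ j → isZero (f j))      ≡⟨ count-none _ (λ j → isZero-false (<⇒≤ (heavy j))) ⟩
  0                               ∎))
  where
    open ≤-Reasoning
    heavy : ∀ j → 2 ≤ f j
    heavy j = ≰⇒> (λ fj≤1 → ¬light (j , fj≤1))

heavy-part-unique : ∀ {m} (f : Fin m → ℕ) → sum f ≤ m → count (λ j → isZero (f j)) ≤ 1 →
                    ∀ i → 2 ≤ f i → f i ≤ 2 × (∀ j → j ≢ i → f j ≤ 1) × ∃[ j ] f j ≡ 0
heavy-part-unique {m} f sum≤m zeros≤1 i heavy =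
  excess≤1 (f i) (≤-trans (term≤sum excess i) excess≤1′) , others-light , zero-part
  where
    excess : Fin m → ℕ
    excess j = f j ∸ 1
    excess≤zeros′ : sum excess ≤ count (λ j → isZero (f j))
    excess≤zeros′ = excess≤zeros f sum≤m
    excess≤1′ : sum excess ≤ 1
    excess≤1′ = ≤-trans excess≤zeros′ zeros≤1
    others-light : ∀ j → j ≢ i → f j ≤ 1
    others-light j j≢i with f j ≤? 1
    ... | yes fj≤1 = fj≤1
    ... | no fj≰1  = ⊥-elim (<-irrefl refl (≤-trans
            (+-mono-≤ (excess-pos (≰⇒> fj≰1)) (excess-pos heavy))
            (≤-trans (two-terms≤sum excess j≢i) excess≤1′)))
    zero-part : ∃[ j ] f j ≡ 0
    zero-part
      with j , e ← count-witness _ (≤-trans (excess-pos heavy) (≤-trans (term≤sum excess i) excess≤zeros′))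
      = j , isZero-true e

data NextView {l} (j : Fin (suc l)) (k : Fin (suc l)) : Set where
  advance : toℕ j < l → toℕ k ≡ suc (toℕ j) → NextView j k
  wraps   : toℕ j ≡ l → toℕ k ≡ 0 → NextView j k

next-view : ∀ {l} (j : Fin (suc l)) → NextView j (next j)
next-view {zero}  zero    = wraps refl refl
next-view {suc l} zero    = advance (s≤s z≤n) refl
next-view {suc l} (suc i) with next {l} i | next-view {l} i
... | zero  | wraps i≡l _    = wraps (cong suc i≡l) refl
... | suc _ | advance i<l e  = advance (s≤s i<l) (cong suc e)

next-inject₁ : ∀ {l} (x : Fin l) → next (inject₁ x) ≡ suc x
next-inject₁ x with next-view (inject₁ x)
... | advance _ e = toℕ-injective (trans e (cong suc (toℕ-inject₁ x)))
... | wraps x≡l _ = ⊥-elim (toℕ-inject₁-≢ x (sym x≡l))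

next-fromℕ : ∀ l → next (fromℕ l) ≡ zero
next-fromℕ l with next-view (fromℕ l)
... | advance l<l _ = ⊥-elim (<-irrefl (toℕ-fromℕ l) l<l)
... | wraps _ e     = toℕ-injective e

next-step : ∀ {l} (j : Fin (suc l)) → toℕ j < l → toℕ (next j) ≡ suc (toℕ j)
next-step j j<l with next-view j
... | advance _ e = e
... | wraps j≡l _ = ⊥-elim (<-irrefl j≡l j<l)

prev : ∀ {l} → Fin (suc l) → Fin (suc l)
prev {l} zero    = fromℕ l
prev     (suc x) = inject₁ x

next-prev : ∀ {l} (j : Fin (suc l)) → next (prev j) ≡ j
next-prev {l} zero    = next-fromℕ l
next-prev     (suc x) = next-inject₁ x

prev-injective : ∀ {l} {a b : Fin (suc l)} → prev a ≡ prev b → a ≡ b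
prev-injective {a = a} {b} e = trans (sym (next-prev a)) (trans (cong next e) (next-prev b))

next-injective : ∀ {l} {a b : Fin (suc l)} → next a ≡ next b → a ≡ b
next-injective {a = a} {b} e with next-view a | next-view b
... | advance _ ea | advance _ eb = toℕ-injective (suc-injective (trans (sym ea) (trans (cong toℕ e) eb)))
... | advance _ ea | wraps _ eb   = ⊥-elim (1+n≢0 (trans (sym ea) (trans (cong toℕ e) eb)))
... | wraps _ ea   | advance _ eb = ⊥-elim (1+n≢0 (trans (sym eb) (trans (cong toℕ (sym e)) ea)))
... | wraps a≡l _  | wraps b≡l _  = toℕ-injective (trans a≡l (sym b≡l))

next-fixed⇒trivial : ∀ {l} (j : Fin (suc l)) → next j ≡ j → l ≡ 0
next-fixed⇒trivial j e with next-view j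
... | advance _ ej = ⊥-elim (1+n≢n (trans (sym ej) (cong toℕ e)))
... | wraps j≡l ej = trans (sym j≡l) (trans (cong toℕ (sym e)) ej)

next²-fixed⇒small : ∀ {l} (j : Fin (suc l)) → next (next j) ≡ j → l ≤ 1
next²-fixed⇒small j e with next-view j | next-view (next j)
... | advance _ ej  | advance _ en  = ⊥-elim (m+1+n≢n 1 (trans (sym (trans en (cong suc ej))) (cong toℕ e)))
... | advance _ ej  | wraps nj≡l en =
  ≤-reflexive (trans (sym nj≡l) (trans ej (cong suc (trans (sym (cong toℕ e)) en))))
... | wraps j≡l ej  | advance _ en  =
  ≤-reflexive (trans (sym j≡l) (trans (sym (cong toℕ e)) (trans en (cong suc ej))))
... | wraps _ ej    | wraps nj≡l _  = ≤-trans (≤-reflexive (trans (sym nj≡l) ej)) z≤n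

climb : ∀ {l} (P : Fin (suc l) → Set) {a : Fin (suc l)} → P a →
        (∀ j → toℕ a ≤ toℕ j → toℕ j < l → P j → P (next j)) →
        ∀ b → toℕ a ≤ toℕ b → P b
climb P {a} Pa preserved b a≤b = reach (toℕ b) b refl a≤b
  where
    reach : ∀ t b → toℕ b ≡ t → toℕ a ≤ t → P b
    reach t b b≡t a≤t with m≤n⇒m<n∨m≡n a≤t
    ... | inj₂ a≡t = subst P (toℕ-injective (trans a≡t (sym b≡t))) Pa
    reach zero    _       _   _ | inj₁ ()
    reach (suc t) zero    ()  _ | inj₁ _
    reach (suc t) (suc x) b≡t _ | inj₁ (s≤s a≤t) =
      subst P (next-inject₁ x) (preserved (inject₁ x) a≤x x<l (reach t (inject₁ x) x≡t a≤t))
      where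
        x≡t : toℕ (inject₁ x) ≡ t
        x≡t = trans (toℕ-inject₁ x) (suc-injective b≡t)
        a≤x : toℕ a ≤ toℕ (inject₁ x)
        a≤x = subst (toℕ a ≤_) (sym x≡t) a≤t
        x<l : toℕ (inject₁ x) < _
        x<l = subst (_< _) (sym (toℕ-inject₁ x)) (toℕ<n x)

next-induction : ∀ {l} (P : Fin (suc l) → Set) {j₀ : Fin (suc l)} → P j₀ →
                 (∀ j → P j → P (next j)) → ∀ j → P j
next-induction {l} P {j₀} Pj₀ preserved j = climb P P-zero (λ j _ _ → preserved j) j z≤n
  where
    P-last : P (fromℕ l)
    P-last = climb P Pj₀ (λ j _ _ → preserved j) (fromℕ l)
               (subst (toℕ j₀ ≤_) (sym (toℕ-fromℕ l)) (≤-pred (toℕ<n j₀)))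
    P-zero : P zero
    P-zero = subst P (next-fromℕ l) (preserved (fromℕ l) P-last)

-- If a set R of at most two positions on a cycle of length at least 3 contains both
-- neighbours of two distinct positions x and x′, then the cycle is x, next x, x′, prev x:
-- the neighbours of x′ must be those of x, swapped.
doubly-isolated-pair : ∀ {l} → 2 ≤ l → (R : Fin (suc l) → Set) →
  (∀ a b d → R a → R b → R d → a ≢ b → a ≢ d → b ≢ d → ⊥) →
  ∀ {x x′} → x ≢ x′ → R (next x) → R (prev x) → R (next x′) → R (prev x′) →
  ∀ j → j ∈ₗ x ∷ next x ∷ x′ ∷ prev x ∷ []
doubly-isolated-pair 2≤l R at-most-two {x} {x′} x≢x′ Ry Rz Ry′ Rz′ =
  next-induction (_∈ₗ x ∷ next x ∷ x′ ∷ prev x ∷ []) (here refl) closed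
  where
    y≢z : next x ≢ prev x
    y≢z y≡z = <⇒≱ 2≤l (next²-fixed⇒small (prev x) (trans (cong next (next-prev x)) y≡z))
    y′≡z : next x′ ≡ prev x
    y′≡z with next x′ ≟ᶠ prev x
    ... | yes e = e
    ... | no y′≢z = ⊥-elim (at-most-two _ _ _ Ry Rz Ry′ y≢z (x≢x′ ∘ next-injective) (y′≢z ∘ sym))
    z′≡y : prev x′ ≡ next x
    z′≡y with prev x′ ≟ᶠ next x
    ... | yes e = e
    ... | no z′≢y = ⊥-elim (at-most-two _ _ _ Ry Rz Rz′ y≢z (z′≢y ∘ sym) (x≢x′ ∘ prev-injective))
    closed : ∀ j → j ∈ₗ x ∷ next x ∷ x′ ∷ prev x ∷ [] → next j ∈ₗ x ∷ next x ∷ x′ ∷ prev x ∷ []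
    closed _ (here refl)                         = there (here refl)
    closed _ (there (here refl))                 =
      there (there (here (trans (cong next (sym z′≡y)) (next-prev x′))))
    closed _ (there (there (here refl)))         = there (there (there (here y′≡z)))
    closed _ (there (there (there (here refl)))) = here (next-prev x)

hamcycle-part-size : ∀ {n m} {G : Graph n} {part : Fin n → Fin m} {i} (C : HamCycle G part i) →
                     (js : List (Fin (suc (len C)))) → (∀ j → j ∈ₗ js) → partSize part i ≤ length js
hamcycle-part-size {part = part} {i} C js covering = begin
  partSize part i             ≤⟨ count-upper _ (map (cyc C) js) in-list ⟩
  length (map (cyc C) js)     ≡⟨ length-map (cyc C) js ⟩
  length js                   ∎
  where
    open ≤-Reasoning
    in-list : ∀ v → ⌊ part v ≟ᶠ i ⌋ ≡ true → v ∈ₗ map (cyc C) js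
    in-list v e with covers C v (⌊⌋-sound (part v ≟ᶠ i) e)
    ... | j , refl = ∈-map⁺ (cyc C) (covering j)

module Paths {n} (G : Graph n) (S : Subset n) where

  infix 4 _⇝_
  _⇝_ : Fin n → Fin n → Set
  u ⇝ v = ReachAvoiding G S u v

  adj-sym : ∀ {u v} → Adj G u v → Adj G v u
  adj-sym {u} {v} uv = trans (Graph.sym G v u) uv

  target∉ : ∀ {u v} → u ⇝ v → v ∉ S
  target∉ (here v∉)    = v∉
  target∉ (step _ _ r) = target∉ r

  ⇝-trans : ∀ {u v w} → u ⇝ v → v ⇝ w → u ⇝ w
  ⇝-trans (here _)        r′ = r′
  ⇝-trans (step u∉ uw r) r′ = step u∉ uw (⇝-trans r r′)

  ⇝-snoc : ∀ {u v w} → u ⇝ v → Adj G v w → w ∉ S → u ⇝ w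
  ⇝-snoc r vw w∉ = ⇝-trans r (step (target∉ r) vw (here w∉))

  ⇝-sym : ∀ {u v} → u ⇝ v → v ⇝ u
  ⇝-sym (here u∉)      = here u∉
  ⇝-sym (step u∉ uw r) = ⇝-snoc (⇝-sym r) (adj-sym uw) u∉

  Sparse : (Fin n → Set) → Set
  Sparse P = ∀ u v → P u → P v → u ∈ S → v ∈ S → u ≡ v

  module _ {m} {part : Fin n → Fin m} {i} (C : HamCycle G part i) where
    private
      c : Fin (suc (len C)) → Fin n
      c = cyc C
      L : ℕ
      L = len C

    along-arc : ∀ a b → toℕ a ≤ toℕ b → (∀ t → toℕ a ≤ toℕ t → toℕ t ≤ toℕ b → c t ∉ S) →
                c a ⇝ c b
    along-arc a b a≤b free = climb (λ j → toℕ j ≤ toℕ b → c a ⇝ c j) start extend b a≤b ≤-refl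
      where
        start : toℕ a ≤ toℕ b → c a ⇝ c a
        start a≤b = here (free a ≤-refl a≤b)
        extend : ∀ j → toℕ a ≤ toℕ j → toℕ j < L →
                 (toℕ j ≤ toℕ b → c a ⇝ c j) → toℕ (next j) ≤ toℕ b → c a ⇝ c (next j)
        extend j a≤j j<L reach nj≤b = ⇝-snoc (reach (<⇒≤ j<b)) (edges C j) (free (next j) a≤nj nj≤b)
          where
            j<b : toℕ j < toℕ b
            j<b = subst (_≤ toℕ b) (next-step j j<L) nj≤b
            a≤nj : toℕ a ≤ toℕ (next j)
            a≤nj = subst (toℕ a ≤_) (sym (next-step j j<L)) (m≤n⇒m≤1+n a≤j)

    closing-edge : Adj G (c zero) (c (fromℕ L))
    closing-edge = adj-sym (subst (λ t → Adj G (c (fromℕ L)) (c t)) (next-fromℕ L) (edges C (fromℕ L)))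

    -- Between surviving positions x ≤ y with p the only removed position, take the arc from
    -- x to y if it misses p, and otherwise the complementary arc through the closing edge.
    around-removed : ∀ p → c p ∈ S → (∀ {t} → c t ∈ S → t ≡ p) →
                     ∀ x y → toℕ x ≤ toℕ y → c x ∉ S → c y ∉ S → c x ⇝ c y
    around-removed p cp only x y x≤y x∉ y∉ with toℕ x ≤? toℕ p | toℕ p ≤? toℕ y
    ... | no x≰p | _ =
      along-arc x y x≤y (λ t x≤t _ ct → x≰p (subst (λ q → toℕ x ≤ toℕ q) (only ct) x≤t))
    ... | yes _ | no p≰y =
      along-arc x y x≤y (λ t _ t≤y ct → p≰y (subst (λ q → toℕ q ≤ toℕ y) (only ct) t≤y))
    ... | yes x≤p | yes p≤y = ⇝-trans x⇝first (step (target∉ x⇝first) closing-edge last⇝y)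
      where
        x⇝first : c x ⇝ c zero
        x⇝first = ⇝-sym (along-arc zero x z≤n below)
          where
            below : ∀ t → 0 ≤ toℕ t → toℕ t ≤ toℕ x → c t ∉ S
            below t _ t≤x ct = x∉ (subst (λ q → c q ∈ S) (sym x≡p) cp)
              where x≡p = toℕ-injective (≤-antisym x≤p (subst (λ q → toℕ q ≤ toℕ x) (only ct) t≤x))
        last⇝y : c (fromℕ L) ⇝ c y
        last⇝y = ⇝-sym (along-arc y (fromℕ L) y≤L above)
          where
            y≤L : toℕ y ≤ toℕ (fromℕ L)
            y≤L = subst (toℕ y ≤_) (sym (toℕ-fromℕ L)) (≤-pred (toℕ<n y))
            above : ∀ t → toℕ y ≤ toℕ t → toℕ t ≤ toℕ (fromℕ L) → c t ∉ S
            above t y≤t _ ct = y∉ (subst (λ q → c q ∈ S) (sym y≡p) cp)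
              where y≡p = toℕ-injective (≤-antisym (subst (λ q → toℕ y ≤ toℕ q) (only ct) y≤t) p≤y)

    sparse-cycle-connected : Sparse (λ v → part v ≡ i) →
                             ∀ x y → toℕ x ≤ toℕ y → c x ∉ S → c y ∉ S → c x ⇝ c y
    sparse-cycle-connected sparse x y x≤y x∉ y∉ with any? (λ t → c t ∈? S)
    ... | no none       = along-arc x y x≤y (λ t _ _ ct → none (t , ct))
    ... | yes (p , cp)  = around-removed p cp only x y x≤y x∉ y∉
      where
        only : ∀ {t} → c t ∈ S → t ≡ p
        only {t} ct = inj C (sparse (c t) (c p) (inPart C t) (inPart C p) ct cp)

    sparse-part-connected : Sparse (λ v → part v ≡ i) →
                            ∀ u v → part u ≡ i → part v ≡ i → u ∉ S → v ∉ S → u ⇝ v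
    sparse-part-connected sparse u v u∈i v∈i u∉ v∉ with covers C u u∈i | covers C v v∈i
    ... | x , refl | y , refl with ≤-total (toℕ x) (toℕ y)
    ... | inj₁ x≤y = sparse-cycle-connected sparse x y x≤y u∉ v∉
    ... | inj₂ y≤x = ⇝-sym (sparse-cycle-connected sparse y x y≤x v∉ u∉)

  matching-survives : ∀ {m} {part : Fin n → Fin m} {j j′} → Matching3 G part j j′ →
                      Sparse (λ v → part v ≡ j) → Sparse (λ v → part v ≡ j′) →
                      ∃[ a ] ∃[ b ] (part a ≡ j × part b ≡ j′ × Adj G a b × a ∉ S × b ∉ S)
  matching-survives {part = part} {j} {j′} (a , b , a-inj , b-inj , a∈j , b∈j′ , ab) sparse sparse′ =
    pick (surviving zero) (surviving (suc zero)) (surviving (suc (suc zero)))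
    where
      Survives : Fin 3 → Set
      Survives t = a t ∉ S × b t ∉ S
      Blocked : Fin 3 → Set
      Blocked t = a t ∈ S ⊎ b t ∈ S
      surviving : ∀ t → Survives t ⊎ Blocked t
      surviving t with a t ∈? S | b t ∈? S
      ... | yes at | _      = inj₂ (inj₁ at)
      ... | no _   | yes bt = inj₂ (inj₂ bt)
      ... | no at  | no bt  = inj₁ (at , bt)
      -- distinct edges cannot lose their ends in the same part, so at most two are blocked
      same-a : ∀ {t t′} → t ≢ t′ → a t ∈ S → a t′ ∈ S → ⊥
      same-a t≢t′ at at′ = t≢t′ (a-inj (sparse _ _ (a∈j _) (a∈j _) at at′))
      same-b : ∀ {t t′} → t ≢ t′ → b t ∈ S → b t′ ∈ S → ⊥
      same-b t≢t′ bt bt′ = t≢t′ (b-inj (sparse′ _ _ (b∈j′ _) (b∈j′ _) bt bt′))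
      three-blocked : Blocked zero → Blocked (suc zero) → Blocked (suc (suc zero)) → ⊥
      three-blocked (inj₁ x) (inj₁ y) _        = same-a (λ ()) x y
      three-blocked (inj₂ x) (inj₂ y) _        = same-b (λ ()) x y
      three-blocked (inj₁ x) (inj₂ _) (inj₁ z) = same-a (λ ()) x z
      three-blocked (inj₁ _) (inj₂ y) (inj₂ z) = same-b (λ ()) y z
      three-blocked (inj₂ x) (inj₁ _) (inj₂ z) = same-b (λ ()) x z
      three-blocked (inj₂ _) (inj₁ y) (inj₁ z) = same-a (λ ()) y z
      pick : Survives zero ⊎ Blocked zero → Survives (suc zero) ⊎ Blocked (suc zero) →
             Survives (suc (suc zero)) ⊎ Blocked (suc (suc zero)) →
             ∃[ a ] ∃[ b ] (part a ≡ j × part b ≡ j′ × Adj G a b × a ∉ S × b ∉ S)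
      pick (inj₁ ok) _ _ = _ , _ , a∈j _ , b∈j′ _ , ab _ , ok
      pick (inj₂ _) (inj₁ ok) _ = _ , _ , a∈j _ , b∈j′ _ , ab _ , ok
      pick (inj₂ _) (inj₂ _) (inj₁ ok) = _ , _ , a∈j _ , b∈j′ _ , ab _ , ok
      pick (inj₂ x) (inj₂ y) (inj₂ z) = ⊥-elim (three-blocked x y z)

-- The connectivity argument for a member G of 𝒢_(m+2), whose parts are indexed by Fin (suc m),
-- after removing a set S of at most m + 1 vertices.
module Connectivity {n m : ℕ} (G : Graph n) (part : Fin n → Fin (suc m))
  (C : (i : Fin (suc m)) → HamCycle G part i)
  (large : ∀ i → 5 ≤ partSize part i)
  (min-degree : MinDegreeAtLeast G (suc (suc m)))
  (matched : ∀ i j → i ≢ j → Matching3 G part i j)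
  (few-missing : ∀ u → missing G part u ≤ 1)
  (missing-apart : ∀ u v → u ≢ v → part u ≡ part v → missing G part u ≡ 1 → missing G part v ≡ 1 →
                   CycleDistAtLeast2 (C (part u)) u v)
  (S : Subset n) (few-removed : ∣ S ∣ ≤ suc m) where

  open Paths G S

  load : Fin (suc m) → ℕ
  load j = count (λ v → lookup S v ∧ ⌊ part v ≟ᶠ j ⌋)

  total-load : sum load ≤ suc m
  total-load = subst (_≤ suc m) (trans (card-as-count S) (count-by-parts (lookup S) part)) few-removed

  removed-in-part : ∀ {j} (xs : List (Fin n)) → Unique xs → All (λ v → v ∈ S × part v ≡ j) xs →
                    length xs ≤ load j
  removed-in-part {j} xs unique removed = count-lower _ xs unique
    (All.map (λ (v∈S , v∈j) → cong₂ _∧_ ([]=⇒lookup v∈S) (⌊⌋-true (_ ≟ᶠ j) v∈j)) removed)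

  unloaded-survives : ∀ {j v} → load j ≡ 0 → part v ≡ j → v ∉ S
  unloaded-survives load≡0 v∈j v∈S =
    1+n≰n (subst (1 ≤_) load≡0 (removed-in-part (_ ∷ []) ([] ∷ []) ((v∈S , v∈j) ∷ [])))

  light-sparse : ∀ {j} → load j ≤ 1 → Sparse (λ v → part v ≡ j)
  light-sparse light u v u∈j v∈j u∈S v∈S with u ≟ᶠ v
  ... | yes u≡v = u≡v
  ... | no u≢v  = ⊥-elim (1+n≰n (≤-trans (removed-in-part (u ∷ v ∷ [])
                    ((u≢v ∷ []) ∷ [] ∷ []) ((u∈S , u∈j) ∷ (v∈S , v∈j) ∷ [])) light))

  two-removed : ∀ {j} → load j ≤ 2 → ∀ u v w → part u ≡ j → part v ≡ j → part w ≡ j →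
                u ∈ S → v ∈ S → w ∈ S → u ≢ v → u ≢ w → v ≢ w → ⊥
  two-removed two u v w u∈j v∈j w∈j u∈S v∈S w∈S u≢v u≢w v≢w = 1+n≰n (≤-trans
    (removed-in-part (u ∷ v ∷ w ∷ []) ((u≢v ∷ u≢w ∷ []) ∷ (v≢w ∷ []) ∷ [] ∷ [])
                     ((u∈S , u∈j) ∷ (v∈S , v∈j) ∷ (w∈S , w∈j) ∷ [])) two)

  -- A surviving vertex hub in a part of load at most 1, to which everything will be connected.
  hub-part : Fin (suc m)
  hub-part = proj₁ (light-part-exists load total-load)

  hub-part-light : load hub-part ≤ 1
  hub-part-light = proj₂ (light-part-exists load total-load)

  hub-exists : ∃[ h ] (part h ≡ hub-part × h ∉ S)
  hub-exists
    with count-escape (λ v → ⌊ part v ≟ᶠ hub-part ⌋) (λ v → lookup S v ∧ ⌊ part v ≟ᶠ hub-part ⌋)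
           (≤-trans (s≤s hub-part-light) (≤-trans (s≤s (s≤s z≤n)) (large hub-part)))
  ... | h , h∈g , h-survives = h , ⌊⌋-sound (part h ≟ᶠ hub-part) h∈g , lookup-false⇒∉ h-outside
    where
      h-outside : lookup S h ≡ false
      h-outside = trans (sym (∧-identityʳ (lookup S h))) (subst (λ b → lookup S h ∧ b ≡ false) h∈g h-survives)

  hub : Fin n
  hub = proj₁ hub-exists

  hub∈g : part hub ≡ hub-part
  hub∈g = proj₁ (proj₂ hub-exists)

  hub∉ : hub ∉ S
  hub∉ = proj₂ (proj₂ hub-exists)

  -- Every surviving vertex of a part of load at most 1 reaches the hub: inside the hub part
  -- along its Hamilton cycle, otherwise through a surviving edge of the matching to the hub part.
  light-reaches-hub : ∀ {j v} → load j ≤ 1 → part v ≡ j → v ∉ S → v ⇝ hub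
  light-reaches-hub {j} {v} light v∈j v∉ with j ≟ᶠ hub-part
  ... | yes refl = sparse-part-connected (C j) (light-sparse light) v hub v∈j hub∈g v∉ hub∉
  ... | no j≢g
    with a , b , a∈j , b∈g , ab , a∉ , b∉ ←
           matching-survives (matched j hub-part j≢g) (light-sparse light) (light-sparse hub-part-light)
    = ⇝-trans (sparse-part-connected (C j) (light-sparse light) v a v∈j a∈j v∉ a∉)
        (step a∉ ab (sparse-part-connected (C hub-part) (light-sparse hub-part-light) b hub b∈g hub∈g b∉ hub∉))

  -- Every vertex has more neighbours than there are removed vertices.
  surviving-neighbour : ∀ u → ∃[ w ] (Adj G u w × w ∉ S)
  surviving-neighbour u
    with w , uw , w∉ ← count-escape (adj G u) (lookup S)
                         (≤-trans (s≤s (subst (_≤ suc m) (card-as-count S) few-removed)) (min-degree u))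
    = w , uw , lookup-false⇒∉ w∉

  -- A neighbour of u in an unloaded part survives and lies in a light part.
  unloaded-neighbour-reaches-hub : ∀ {u j} → load j ≡ 0 → isZero (degIn G part u j) ≡ false →
                                   u ∉ S → u ⇝ hub
  unloaded-neighbour-reaches-hub {u} {j} load≡0 adjacent u∉
    with v , e ← count-witness (λ v → adj G u v ∧ ⌊ part v ≟ᶠ j ⌋) (isZero-false⇒positive adjacent)
    = step u∉ (∧-conicalˡ _ _ e)
        (light-reaches-hub (subst (_≤ 1) (sym load≡0) z≤n) v∈j (unloaded-survives load≡0 v∈j))
    where
      v∈j : part v ≡ j
      v∈j = ⌊⌋-sound (part v ≟ᶠ j) (∧-conicalʳ _ _ e)

  missed-by : Fin n → Fin (suc m) → Bool
  missed-by u j = not ⌊ j ≟ᶠ part u ⌋ ∧ isZero (degIn G part u j)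

  -- A vertex of a heavy part with no neighbour in an unloaded part misses every unloaded
  -- part, so by (v) at most one part is unloaded.
  few-unloaded : ∀ u → 2 ≤ load (part u) → (∀ j → load j ≡ 0 → isZero (degIn G part u j) ≡ true) →
                 count (λ j → isZero (load j)) ≤ 1
  few-unloaded u heavy no-neighbour = ≤-trans (count-mono _ _ missed) (few-missing u)
    where
      missed : ∀ j → isZero (load j) ≡ true → missed-by u j ≡ true
      missed j e = cong₂ _∧_ (cong not (⌊⌋-false (j ≟ᶠ part u) j≢u)) (no-neighbour j (isZero-true e))
        where
          j≢u : j ≢ part u
          j≢u refl = n≮0 (subst (2 ≤_) (isZero-true e) heavy)

  module HeavyPart (i j₀ : Fin (suc m)) (j₀≢i : j₀ ≢ i) (unloaded : load j₀ ≡ 0)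
                   (others-light : ∀ j → j ≢ i → load j ≤ 1) (i-load≤2 : load i ≤ 2) where
    private
      c : Fin (suc (len (C i))) → Fin n
      c = cyc (C i)

    prev-edge : ∀ x → Adj G (c (prev x)) (c x)
    prev-edge x = subst (λ t → Adj G (c (prev x)) (c t)) (next-prev x) (edges (C i) (prev x))

    -- A vertex of V_i missing no part has a neighbour in the unloaded part V_j₀.
    complete-reaches-hub : ∀ {w} → part w ≡ i → missing G part w ≢ 1 → w ∉ S → w ⇝ hub
    complete-reaches-hub {w} w∈i not-missing w∉ with isZero (degIn G part w j₀) in e
    ... | false = unloaded-neighbour-reaches-hub unloaded e w∉
    ... | true  = ⊥-elim (not-missing (≤-antisym (few-missing w)
                    (count-lower (missed-by w) (j₀ ∷ []) ([] ∷ []) (j₀-missed ∷ []))))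
      where
        j₀-missed : missed-by w j₀ ≡ true
        j₀-missed = cong₂ _∧_ (cong not (⌊⌋-false (j₀ ≟ᶠ part w) (j₀≢i ∘ (λ j₀≡w → trans j₀≡w w∈i)))) e

    consecutive-not-both-missing : ∀ x → missing G part (c x) ≡ 1 → missing G part (c (next x)) ≡ 1 → ⊥
    consecutive-not-both-missing x mx mnx =
      proj₂ (subst (λ k → CycleDistAtLeast2 (C k) (c x) (c (next x))) (inPart (C i) x) apart) (x , inj₁ (refl , refl))
      where
        distinct : c x ≢ c (next x)
        distinct e = n≮0 (subst (2 ≤_) (next-fixed⇒trivial x (sym (inj (C i) e))) (len≥2 (C i)))
        apart : CycleDistAtLeast2 (C (part (c x))) (c x) (c (next x))
        apart = missing-apart (c x) (c (next x)) distinct (trans (inPart (C i) x) (sym (inPart (C i) (next x)))) mx mnx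

    -- A surviving vertex of V_i with a surviving cycle neighbour reaches the hub: if it misses
    -- a part, the neighbour misses none.
    along-cycle-reaches-hub : ∀ x → c x ∉ S → c (next x) ∉ S ⊎ c (prev x) ∉ S → c x ⇝ hub
    along-cycle-reaches-hub x x∉ neighbour with missing G part (c x) ≟ 1 | neighbour
    ... | no ¬mx | _ = complete-reaches-hub (inPart (C i) x) ¬mx x∉
    ... | yes mx | inj₁ nx∉ = step x∉ (edges (C i) x)
          (complete-reaches-hub (inPart (C i) (next x)) (consecutive-not-both-missing x mx) nx∉)
    ... | yes mx | inj₂ px∉ = step x∉ (adj-sym (prev-edge x))
          (complete-reaches-hub (inPart (C i) (prev x)) (λ mp → consecutive-not-both-missing (prev x) mp mx′) px∉)
      where
        mx′ : missing G part (c (next (prev x))) ≡ 1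
        mx′ = subst (λ t → missing G part (c t) ≡ 1) (sym (next-prev x)) mx

    -- Two distinct vertices of V_i whose cycle neighbours are all removed would force |V_i| ≤ 4.
    not-two-enclosed : ∀ {x x′} → x ≢ x′ → c (next x) ∈ S → c (prev x) ∈ S →
                       c (next x′) ∈ S → c (prev x′) ∈ S → ⊥
    not-two-enclosed x≢x′ nx∈ px∈ nx′∈ px′∈ = 1+n≰n (≤-trans (large i) (hamcycle-part-size (C i) _
      (doubly-isolated-pair (len≥2 (C i)) (λ t → c t ∈ S) three-removed x≢x′ nx∈ px∈ nx′∈ px′∈)))
      where
        three-removed : ∀ a b d → c a ∈ S → c b ∈ S → c d ∈ S → a ≢ b → a ≢ d → b ≢ d → ⊥
        three-removed a b d a∈ b∈ d∈ a≢b a≢d b≢d = two-removed i-load≤2 (c a) (c b) (c d)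
          (inPart (C i) a) (inPart (C i) b) (inPart (C i) d) a∈ b∈ d∈
          (a≢b ∘ inj (C i)) (a≢d ∘ inj (C i)) (b≢d ∘ inj (C i))

    cycle-neighbours : ∀ x → (c (next x) ∉ S ⊎ c (prev x) ∉ S) ⊎ (c (next x) ∈ S × c (prev x) ∈ S)
    cycle-neighbours x with c (next x) ∈? S | c (prev x) ∈? S
    ... | no nx∉  | _       = inj₁ (inj₁ nx∉)
    ... | yes _   | no px∉  = inj₁ (inj₂ px∉)
    ... | yes nx∈ | yes px∈ = inj₂ (nx∈ , px∈)

    -- A vertex whose two cycle neighbours are removed leaves through a surviving neighbour w,
    -- which lies in a light part or, inside V_i, has a surviving cycle neighbour.
    enclosed-reaches-hub : ∀ x → c x ∉ S → c (next x) ∈ S → c (prev x) ∈ S → c x ⇝ hub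
    enclosed-reaches-hub x x∉ nx∈ px∈ with surviving-neighbour (c x)
    ... | w , xw , w∉ with part w ≟ᶠ i
    ... | no w∉i = step x∉ xw (light-reaches-hub (others-light (part w) w∉i) refl w∉)
    ... | yes w∈i with covers (C i) w w∈i
    ... | x′ , refl with cycle-neighbours x′
    ... | inj₁ escape           = step x∉ xw (along-cycle-reaches-hub x′ w∉ escape)
    ... | inj₂ (nx′∈ , px′∈)    = ⊥-elim (not-two-enclosed x≢x′ nx∈ px∈ nx′∈ px′∈)
      where
        x≢x′ : x ≢ x′
        x≢x′ refl with () ← trans (sym xw) (irrefl G (c x))

    heavy-reaches-hub : ∀ {u} → part u ≡ i → u ∉ S → u ⇝ hub
    heavy-reaches-hub {u} u∈i u∉ with covers (C i) u u∈i
    ... | x , refl with cycle-neighbours x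
    ... | inj₁ escape        = along-cycle-reaches-hub x u∉ escape
    ... | inj₂ (nx∈ , px∈)   = enclosed-reaches-hub x u∉ nx∈ px∈

  -- A vertex of a light part does so directly, and so
  -- does one adjacent to an unloaded part; otherwise the counting of loads leaves exactly the
  -- situation of HeavyPart.
  reaches-hub : ∀ u → u ∉ S → u ⇝ hub
  reaches-hub u u∉ with load (part u) ≤? 1
  ... | yes light = light-reaches-hub light refl u∉
  ... | no ¬light with any? (λ j → load j ≟ 0 ×-dec isZero (degIn G part u j) ≟ᵇ false)
  ... | yes (j , load≡0 , adjacent) = unloaded-neighbour-reaches-hub load≡0 adjacent u∉
  ... | no ¬adjacent
    with two , others-light , j₀ , unloaded ← heavy-part-unique load total-load
           (few-unloaded u (≰⇒> ¬light) (λ j load≡0 → ¬-not (¬adjacent ∘ (λ adjacent → j , load≡0 , adjacent))))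
           (part u) (≰⇒> ¬light)
    = HeavyPart.heavy-reaches-hub (part u) j₀ j₀≢u unloaded others-light two refl u∉
    where
      j₀≢u : j₀ ≢ part u
      j₀≢u refl = n≮0 (subst (2 ≤_) unloaded (≰⇒> ¬light))

  connected : ConnectedAvoiding G S
  connected u v u∉ v∉ = ⇝-trans (reaches-hub u u∉) (⇝-sym (reaches-hub v v∉))

family-connected : ∀ {m n} (G : Graph n) → InFamily (suc (suc m)) n G →
                   ∀ (S : Subset n) → ∣ S ∣ < suc (suc m) → ConnectedAvoiding G S
family-connected G (part , C , large , min-degree , matched , few-missing , missing-apart) S small =
  Connectivity.connected G part C large min-degree matched few-missing missing-apart S (≤-pred small)

proposition2p1 : ∀ (k : ℕ) → 3 ≤ k →
    ∃[ n₀ ] ∀ (n : ℕ) → n₀ ≤ n → ∀ (G : Graph n) → InFamily k n G → KConnected k G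
proposition2p1 (suc (suc (suc k))) (s≤s (s≤s (s≤s z≤n))) =
  suc (suc (suc (suc k))) , λ n k<n G member → k<n , family-connected G member
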